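{- Let $p$ be an odd prime, $\lambda\ge1$ an integer, $d=p^\lambda+1$, $S=\mathbb{Z}/d\mathbb{Z}\setminus\{0,d/2\}$, $S_v=\{b\in S:0<b<d/2\}$, $S_f=\{b\in S:d/2<b<d\}$ (least nonnegative residues). For $b\in S$ let $\mathrm{pat}'(b)=u_{\lambda-1}\cdots u_0$ be the word of length $\lambda$ on $\{f,v\}$ with $u_j=f$ if $p^jb\in S_f$ and $u_j=v$ if $p^jb\in S_v$. For a word $w$ of length $\lambda$ let $\mu'(w)=\#\{b\in S:\mathrm{pat}'(b)=w\}$, and for a word $t$ of length $\le\lambda$ let $\mu'(\text{ --- }t)$ be the number of $b\in S$ such that $\mathrm{pat}'(b)=t'\cdot t$ for some word $t'$ (i.e. $\mathrm{pat}'(b)$ ends with $t$). For a word $t$ write $t^c$ for the word obtained by exchanging $f$ and $v$. (1) Let $e_1,\dots,e_k$ be positive integers with $\sum e_i=\lambda$. If $k$ is odd, then $\mu'(f^{e_k}v^{e_{k-1}}\cdots v^{e_2}f^{e_1})=\mu'(v^{e_k}f^{e_{k-1}}\cdots f^{e_2}v^{e_1})=\left(\frac{p+1}2\right)^{\lambda-k}\left(\frac{p-1}2\right)^k$; if $k$ is even, then $\mu'(v^{e_k}f^{e_{k-1}}\cdots v^{e_2}f^{e_1})=\mu'(f^{e_k}v^{e_{k-1}}\cdots f^{e_2}v^{e_1})=\left(\frac{p+1}2\right)^{\lambda+1-k}\left(\frac{p-1}2\right)^{k-1}$. (2) More generally, let $e_1,\dots,e_k$ be positive integers with $\lambda'=\sum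 e_i\le\lambda$. If $k$ is odd and $t=f^{e_k}v^{e_{k-1}}\cdots v^{e_2}f^{e_1}$, then $\mu'(\text{ --- }t)=\mu'(\text{ --- }t^c)=\left(\frac{p+1}2\right)^{\lambda'-k}\left(\frac{p-1}2\right)^{k-1}\frac{p^{\lambda+1-\lambda'}-1}2$; if $k$ is even and $t=v^{e_k}f^{e_{k-1}}\cdots v^{e_2}f^{e_1}$, then $\mu'(\text{ --- }t)=\mu'(\text{ --- }t^c)=\left(\frac{p+1}2\right)^{\lambda'-k}\left(\frac{p-1}2\right)^{k-1}\frac{p^{\lambda+1-\lambda'}+1}2$.
   Context: Words on $\{f,v\}$ are written $u_{m-1}\cdots u_0$; exponents denote repeated letters, and in the displayed words the blocks alternate between powers of $f$ and powers of $v$. -}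

module Defs where

open import Data.Nat using (ℕ; zero; suc; _+_; _*_; _∸_; _^_; _<?_; _≟_)
open import Data.Nat.DivMod using (_/_; _%_)
open import Data.Bool using (if_then_else_)
open import Data.List using (List; []; _∷_; _++_; map; replicate; reverse; upTo; filter; length)
open import Data.List.Properties using (≡-dec)
open import Data.List.Relation.Binary.Suffix.Heterogeneous using (Suffix)
open import Data.List.Relation.Binary.Suffix.Heterogeneous.Properties using (suffix?)
open import Relation.Nullary using (Dec; yes; no; ¬?; does)
open import Relation.Nullary.Decidable using (_×-dec_)
open import Relation.Binary.PropositionalEquality using (_≡_; refl)

data Letter : Set where
  f v : Letter

_≟L_ : (x y : Letter) → Dec (x ≡ y)
f ≟L f = yes refl
f ≟L v = no λ ()
v ≟L f = no λ ()
v ≟L v = yes refl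

-- A word u_{m-1} ⋯ u_0 is the list [u_{m-1}, …, u_0] (written order:
-- head is the leftmost letter u_{m-1}, last element is u_0).
Word : Set
Word = List Letter

_≟W_ : (w w' : Word) → Dec (w ≡ w')
_≟W_ = ≡-dec _≟L_

swap : Letter → Letter
swap f = v
swap v = f

_ᶜ : Word → Word
t ᶜ = map swap t

-- blocks x [e₁, …, e_k] = y_k^{e_k} ⋯ y_2^{e_2} x^{e_1},
-- blocks alternating, the rightmost block (exponent e₁) being a power of x.
blocks : Letter → List ℕ → Word
blocks x []       = []
blocks x (e ∷ es) = blocks (swap x) es ++ replicate e x

module Setup (p lam : ℕ) where
  d : ℕ
  d = suc (p ^ lam)

  -- d/2 = (p^λ + 1)/2  (d is even since p is odd)
  half : ℕ
  half = d / 2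

  S : List ℕ
  S = filter (λ b → ¬? (b ≟ 0) ×-dec ¬? (b ≟ half)) (upTo d)

  -- u_j : f if p^j b mod d ∈ S_f (i.e. d/2 < p^j b mod d < d), v otherwise
  -- (for b ∈ S, p^j b mod d ∈ S, so "otherwise" means ∈ S_v)
  letter : ℕ → ℕ → Letter
  letter b j = if does (half <? ((p ^ j * b) % d)) then f else v

  pat : ℕ → Word
  pat b = reverse (map (letter b) (upTo lam))

  μ : Word → ℕ
  μ w = length (filter (λ b → pat b ≟W w) S)

  μ-end : Word → ℕ
  μ-end t = length (filter (λ b → suffix? _≟L_ t (pat b)) S)

-- Write p = 2h + 1, b = n + 1 with n < p^λ, and H m = (p^m - 1)/2, whose base-p digits all equal h.
-- As p^λ ≡ -1 modulo d, the residue of p^j b is p^j (s + 1) - q, where s and q are the last λ - j and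
-- the first j digits of n; comparing it with d/2 = H λ + 1 shows that u_j records whether s lies above
-- or below the last λ - j digits of H λ, a tie being decided by the sign of n - H λ. Hence u_j is read
-- off from u_{j+1} and one digit a of n: a is compared with h, and a = h copies u_{j+1}. Counting digit
-- by digit, a letter u followed by x arises from h + [u = x] values of a, and the last prescribed letter
-- u_{λ'-1}, which compares the remaining λ + 1 - λ' digits, from H (λ + 1 - λ') + [tie] values. For a
-- block word this gives (p+1)/2 inside blocks and (p-1)/2 at block changes, the parity of k fixes the
-- last factor, and μ′ is the case λ' = λ of μ′(---t).
module Submission where

open import Defs
open import Data.Bool using (Bool; true; false; _∧_; not; if_then_else_)
open import Data.Bool.Properties using (∧-zeroʳ; ∧-identityʳ)
open import Data.Empty using (⊥-elim)
open import Data.List using (List; []; _∷_; _∷ʳ_; _++_; length; map; replicate; reverse; upTo; applyUpTo; filter)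
open import Data.List.Properties
  using (length-++; length-replicate; length-reverse; length-map; length-upTo; map-upTo;
         map-++; map-replicate; reverse-++; unfold-reverse; filter-≐; map-cong-local)
open import Data.List.Relation.Unary.All using (All; []; _∷_)
open import Data.List.Relation.Unary.All.Properties using (applyUpTo⁺₁)
open import Data.List.Relation.Binary.Pointwise using (Pointwise-≡⇒≡; ≡⇒Pointwise-≡)
open import Data.List.Relation.Binary.Prefix.Heterogeneous.Properties using (prefix?)
open import Data.List.Relation.Binary.Suffix.Heterogeneous using (Suffix; here)
open import Data.List.Relation.Binary.Suffix.Heterogeneous.Properties
  using (suffix?; toPrefix; fromPrefix; toPointwise)
open import Data.Nat
  using (ℕ; zero; suc; _+_; _*_; _∸_; _^_; _≤_; _<_; _%_; _/_; _<?_; _≟_; s≤s; z≤n; z<s; s<s; NonZero)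
open import Data.Nat.Divisibility using (_∣_; divides)
open import Data.Nat.DivMod
  using (m≡m%n+[m/n]*n; m%n<n; m<n⇒m%n≡m; m<n⇒m/n≡0; m/n≡1+[m∸n]/n; [m+n]%n≡m%n; [m+kn]%n≡m%n;
         m*n/n≡m; m∣n⇒o%n%m≡o%m; m<n*o⇒m/o<n)
open import Data.Nat.ListAction using (sum)
open import Data.Nat.Primality using (Prime)
open import Data.Nat.Properties
open import Data.Nat.Tactic.RingSolver using (solve-∀)
open import Data.Product using (Σ; _×_; _,_)
open import Function using (_∘_; id; mk⇔)
open import Relation.Binary.Definitions using (Tri; tri<; tri≈; tri>)
open import Relation.Binary.PropositionalEquality
  using (_≡_; _≢_; refl; sym; trans; cong; cong₂; subst; module ≡-Reasoning)
open import Relation.Nullary using (¬_; Dec; yes; no; does; ¬?)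
open import Relation.Nullary.Decidable using (dec-true; dec-false; does-⇔; _×-dec_)
open import Relation.Unary using (Pred; Decidable)

indicator : Bool → ℕ
indicator true  = 1
indicator false = 0

count : (ℕ → Bool) → ℕ → ℕ
count g zero    = 0
count g (suc n) = indicator (g 0) + count (g ∘ suc) n

count-cong : ∀ {g g′} n → (∀ {i} → i < n → g i ≡ g′ i) → count g n ≡ count g′ n
count-cong zero    _  = refl
count-cong (suc n) eq = cong₂ _+_ (cong indicator (eq z<s)) (count-cong n (eq ∘ s<s))

count-+ : ∀ g m n → count g (m + n) ≡ count g m + count (λ i → g (m + i)) n
count-+ g zero    n = refl
count-+ g (suc m) n = trans (cong (indicator (g 0) +_) (count-+ (g ∘ suc) m n))
                            (sym (+-assoc (indicator (g 0)) _ _))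

count-const : ∀ b n → count (λ _ → b) n ≡ indicator b * n
count-const true  zero    = refl
count-const true  (suc n) = cong suc (count-const true n)
count-const false zero    = refl
count-const false (suc n) = count-const false n

count-∧ˡ : ∀ b k n → count (λ i → b ∧ k i) n ≡ indicator b * count k n
count-∧ˡ true  k n = sym (+-identityʳ (count k n))
count-∧ˡ false k n = count-const false n

count-/-% : ∀ a N .{{_ : NonZero N}} (g k : ℕ → Bool) →
  count (λ i → g (i / N) ∧ k (i % N)) (a * N) ≡ count g a * count k N
count-/-% zero    N g k = refl
count-/-% (suc a) N g k = begin
    count F (N + a * N)
      ≡⟨ count-+ F N (a * N) ⟩
    count F N + count (λ i → F (N + i)) (a * N)
      ≡⟨ cong₂ _+_ (count-cong N (λ i<N → cong₂ (λ x y → g x ∧ k y) (m<n⇒m/n≡0 i<N) (m<n⇒m%n≡m i<N)))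
                   (count-cong (a * N) (λ {i} _ → cong₂ (λ x y → g x ∧ k y) (shift-/ i) (shift-% i))) ⟩
    count (λ i → g 0 ∧ k i) N + count (λ i → g (suc (i / N)) ∧ k (i % N)) (a * N)
      ≡⟨ cong₂ _+_ (count-∧ˡ (g 0) k N) (count-/-% a N (g ∘ suc) k) ⟩
    indicator (g 0) * count k N + count (g ∘ suc) a * count k N
      ≡⟨ sym (*-distribʳ-+ (count k N) (indicator (g 0)) _) ⟩
    count g (suc a) * count k N ∎
  where
  open ≡-Reasoning
  F : ℕ → Bool
  F i = g (i / N) ∧ k (i % N)
  shift-/ : ∀ i → (N + i) / N ≡ suc (i / N)
  shift-/ i = trans (m/n≡1+[m∸n]/n (m≤m+n N i)) (cong (λ j → suc (j / N)) (m+n∸m≡n N i))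
  shift-% : ∀ i → (N + i) % N ≡ i % N
  shift-% i = trans (cong (_% N) (+-comm N i)) ([m+n]%n≡m%n i N)

length-filter-filter : ∀ {p q} {P : Pred ℕ p} {Q : Pred ℕ q} (P? : Decidable P) (Q? : Decidable Q) φ n →
  length (filter P? (filter Q? (applyUpTo φ n))) ≡ count (λ i → does (Q? (φ i)) ∧ does (P? (φ i))) n
length-filter-filter P? Q? φ zero = refl
length-filter-filter P? Q? φ (suc n) with does (Q? (φ 0))
... | false = length-filter-filter P? Q? (φ ∘ suc) n
... | true with does (P? (φ 0))
...   | true  = cong suc (length-filter-filter P? Q? (φ ∘ suc) n)
...   | false = length-filter-filter P? Q? (φ ∘ suc) n

δ : Letter → Letter → ℕ
δ x y = indicator (does (x ≟L y))

δ-refl : ∀ x → δ x x ≡ 1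
δ-refl f = refl
δ-refl v = refl

δ-swap : ∀ x → δ x (swap x) ≡ 0
δ-swap f = refl
δ-swap v = refl

swap-involutive : ∀ x → swap (swap x) ≡ x
swap-involutive f = refl
swap-involutive v = refl

swap-≢ : ∀ x → x ≢ swap x
swap-≢ f ()
swap-≢ v ()

side : ℕ → ℕ → Letter → Letter
side a k z with <-cmp a k
... | tri< _ _ _ = v
... | tri≈ _ _ _ = z
... | tri> _ _ _ = f

side-< : ∀ {a k} z → a < k → side a k z ≡ v
side-< {a} {k} z a<k with <-cmp a k
... | tri< _ _ _   = refl
... | tri≈ ¬a<k _ _ = ⊥-elim (¬a<k a<k)
... | tri> ¬a<k _ _ = ⊥-elim (¬a<k a<k)

side-> : ∀ {a k} z → k < a → side a k z ≡ f
side-> {a} {k} z k<a with <-cmp a k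
... | tri< _ _ ¬k<a = ⊥-elim (¬k<a k<a)
... | tri≈ _ _ ¬k<a = ⊥-elim (¬k<a k<a)
... | tri> _ _ _    = refl

side-≡ : ∀ {a k} z → a ≡ k → side a k z ≡ z
side-≡ {a} {k} z a≡k with <-cmp a k
... | tri< _ a≢k _ = ⊥-elim (a≢k a≡k)
... | tri≈ _ _ _   = refl
... | tri> _ a≢k _ = ⊥-elim (a≢k a≡k)

side-≥ : ∀ {a k} → k ≤ a → side a k f ≡ f
side-≥ {a} {k} k≤a with <-cmp a k
... | tri< a<k _ _ = ⊥-elim (<⇒≱ a<k k≤a)
... | tri≈ _ _ _   = refl
... | tri> _ _ _   = refl

side-tie : ∀ {a k z z′} → (a ≡ k → z ≡ z′) → side a k z ≡ side a k z′
side-tie {a} {k} eq with <-cmp a k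
... | tri< _ _ _   = refl
... | tri≈ _ a≡k _ = eq a≡k
... | tri> _ _ _   = refl

digits-< : ∀ {r K a b N} → r < N → a < b → r + a * N < K + b * N
digits-< {r} {K} {a} {b} {N} r<N a<b = begin-strict
  r + a * N <⟨ +-monoˡ-< (a * N) r<N ⟩
  N + a * N ≤⟨ *-monoˡ-≤ N a<b ⟩
  b * N     ≤⟨ m≤n+m (b * N) K ⟩
  K + b * N ∎
  where open ≤-Reasoning

side-lex : ∀ {r K a b N} z → r < N → K < N → side (r + a * N) (K + b * N) z ≡ side a b (side r K z)
side-lex {r} {K} {a} {b} {N} z r<N K<N with <-cmp a b
... | tri< a<b _ _ = side-< z (digits-< r<N a<b)
... | tri> _ _ b<a = side-> z (digits-< K<N b<a)
... | tri≈ _ refl _ with <-cmp r K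
...   | tri< r<K _ _  = side-< z (+-monoˡ-< (a * N) r<K)
...   | tri> _ _ K<r  = side-> z (+-monoˡ-< (a * N) K<r)
...   | tri≈ _ refl _ = side-≡ z refl

count-side : ∀ K z u → count (λ a → does (u ≟L side a K z)) (suc (K + K)) ≡ K + δ u z
count-side K z u = begin
    count g (suc (K + K))
      ≡⟨ cong (count g) (sym (+-suc K K)) ⟩
    count g (K + suc K)
      ≡⟨ count-+ g K (suc K) ⟩
    count g K + (indicator (g (K + 0)) + count (λ i → g (K + suc i)) K)
      ≡⟨ cong₂ _+_ (count-cong K (λ i<K → cong (does ∘ (u ≟L_)) (side-< z i<K)))
                   (cong₂ _+_ (cong (indicator ∘ does ∘ (u ≟L_)) (side-≡ z (+-identityʳ K)))
                              (count-cong K (λ _ → cong (does ∘ (u ≟L_)) (side-> z (m<m+n K z<s))))) ⟩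
    count (λ _ → does (u ≟L v)) K + (δ u z + count (λ _ → does (u ≟L f)) K)
      ≡⟨ cong₂ (λ m n → m + (δ u z + n)) (count-const _ K) (count-const _ K) ⟩
    δ u v * K + (δ u z + δ u f * K)
      ≡⟨ collect u ⟩
    K + δ u z ∎
  where
  open ≡-Reasoning
  g : ℕ → Bool
  g a = does (u ≟L side a K z)
  collect : ∀ u → δ u v * K + (δ u z + δ u f * K) ≡ K + δ u z
  collect f = trans (cong (δ f z +_) (+-identityʳ K)) (+-comm (δ f z) K)
  collect v = cong₂ _+_ (+-identityʳ K) (+-identityʳ (δ v z))

replicate-∷ʳ : ∀ {A : Set} n (x : A) → replicate n x ∷ʳ x ≡ x ∷ replicate n x
replicate-∷ʳ zero    x = refl
replicate-∷ʳ (suc n) x = cong (x ∷_) (replicate-∷ʳ n x)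

reverse-replicate : ∀ {A : Set} n (x : A) → reverse (replicate n x) ≡ replicate n x
reverse-replicate zero    x = refl
reverse-replicate (suc n) x = trans (unfold-reverse x (replicate n x))
  (trans (cong (_∷ʳ x) (reverse-replicate n x)) (replicate-∷ʳ n x))

blocksᴿ : Letter → List ℕ → Word
blocksᴿ x []       = []
blocksᴿ x (e ∷ es) = replicate e x ++ blocksᴿ (swap x) es

blocks≡reverse-blocksᴿ : ∀ x es → blocks x es ≡ reverse (blocksᴿ x es)
blocks≡reverse-blocksᴿ x []       = refl
blocks≡reverse-blocksᴿ x (e ∷ es) = begin
  blocks (swap x) es ++ replicate e x                    ≡⟨ cong₂ _++_ (blocks≡reverse-blocksᴿ (swap x) es)
                                                                        (sym (reverse-replicate e x)) ⟩
  reverse (blocksᴿ (swap x) es) ++ reverse (replicate e x) ≡⟨ sym (reverse-++ (replicate e x) _) ⟩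
  reverse (blocksᴿ x (e ∷ es))                           ∎
  where open ≡-Reasoning

length-blocksᴿ : ∀ x es → length (blocksᴿ x es) ≡ sum es
length-blocksᴿ x []       = refl
length-blocksᴿ x (e ∷ es) = trans (length-++ (replicate e x))
  (cong₂ _+_ (length-replicate e) (length-blocksᴿ (swap x) es))

length-blocks : ∀ x es → length (blocks x es) ≡ sum es
length-blocks x es = trans (cong length (blocks≡reverse-blocksᴿ x es))
  (trans (length-reverse (blocksᴿ x es)) (length-blocksᴿ x es))

blocks-ᶜ : ∀ x es → blocks x es ᶜ ≡ blocks (swap x) es
blocks-ᶜ x []       = refl
blocks-ᶜ x (e ∷ es) = trans (map-++ swap (blocks (swap x) es) (replicate e x))
  (cong₂ _++_ (blocks-ᶜ (swap x) es) (map-replicate swap e x))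

-- blockLetter x i is the letter of the block with exponent e_{i+1} in blocks x es.
blockLetter : Letter → ℕ → Letter
blockLetter x zero    = x
blockLetter x (suc i) = blockLetter (swap x) i

blockLetter-even : ∀ x i → suc i % 2 ≡ 1 → blockLetter x i ≡ x
blockLetter-even x zero          _   = refl
blockLetter-even x (suc zero)    ()
blockLetter-even x (suc (suc i)) odd = trans (blockLetter-even (swap (swap x)) i odd) (swap-involutive x)

blockLetter-odd : ∀ x i → suc i % 2 ≡ 0 → blockLetter x i ≡ swap x
blockLetter-odd x zero          ()
blockLetter-odd x (suc zero)    _    = refl
blockLetter-odd x (suc (suc i)) even =
  trans (blockLetter-odd (swap (swap x)) i even) (cong swap (swap-involutive x))

length≤sum : ∀ {es} → All (1 ≤_) es → length es ≤ sum es
length≤sum []                    = z≤n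
length≤sum {suc e ∷ es} (_ ∷ es⁺) = s≤s (≤-trans (length≤sum es⁺) (m≤n+m (sum es) e))

nonempty : ∀ (es : List ℕ) → 1 ≤ sum es → 1 ≤ length es
nonempty (_ ∷ _) _ = s≤s z≤n

with-complement : ∀ (P : Word → Set) es → (∀ x → P (blocks x es)) → P (blocks f es) × P (blocks f es ᶜ)
with-complement P es P-blocks = P-blocks f , subst P (sym (blocks-ᶜ f es)) (P-blocks v)

isPrefix : Word → Word → Bool
isPrefix t w = does (prefix? _≟L_ t w)

isSuffix-reverse : ∀ t w → does (suffix? _≟L_ (reverse t) (reverse w)) ≡ isPrefix t w
isSuffix-reverse t w = does-⇔ (mk⇔ toPrefix fromPrefix) (suffix? _≟L_ (reverse t) (reverse w)) (prefix? _≟L_ t w)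

isPrefix-≢ : ∀ {u y} t w → u ≢ y → isPrefix (u ∷ t) (y ∷ w) ≡ false
isPrefix-≢ {u} {y} t w u≢y = cong (_∧ isPrefix t w) (dec-false (u ≟L y) u≢y)

∧-guard : ∀ (F : Letter → Bool) x c b → F c ∧ (does (x ≟L c) ∧ b) ≡ F x ∧ (does (x ≟L c) ∧ b)
∧-guard F x c b with x ≟L c
... | yes refl = refl
... | no _     = trans (∧-zeroʳ (F c)) (sym (∧-zeroʳ (F x)))

half-double : ∀ a → (a + a) / 2 ≡ a
half-double a = trans (cong (_/ 2) (double a)) (m*n/n≡m a 2)
  where
  double : ∀ a → a + a ≡ a * 2
  double = solve-∀

half-suc-double : ∀ a → suc (suc (a + a)) / 2 ≡ suc a
half-suc-double a = trans (cong (_/ 2) (double a)) (m*n/n≡m (suc a) 2)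
  where
  double : ∀ a → suc (suc (a + a)) ≡ suc a * 2
  double = solve-∀

odd⇒suc-double : ∀ {n} → ¬ 2 ∣ n → Σ ℕ λ h → n ≡ suc (h + h)
odd⇒suc-double {zero}        2∤n = ⊥-elim (2∤n (divides 0 refl))
odd⇒suc-double {suc zero}    _   = 0 , refl
odd⇒suc-double {suc (suc n)} 2∤n with odd⇒suc-double {n} (λ { (divides k eq) → 2∤n (divides (suc k) (cong (suc ∘ suc) eq)) })
... | h , refl = suc h , cong (suc ∘ suc) (sym (+-suc h h))

-- A suffix of pat′(b) of full length λ is pat′(b) itself.
μ≡μ-end : ∀ p lam w → length w ≡ lam → Setup.μ p lam w ≡ Setup.μ-end p lam w
μ≡μ-end p lam w ∣w∣≡lam = cong length (filter-≐ (λ b → pat b ≟W w) (λ b → suffix? _≟L_ w (pat b)) (to , from) S)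
  where
  open Setup p lam
  length-pat : ∀ b → length (pat b) ≡ lam
  length-pat b = trans (length-reverse (map (letter b) (upTo lam)))
    (trans (length-map (letter b) (upTo lam)) (length-upTo lam))
  to : ∀ {b} → pat b ≡ w → Suffix _≡_ w (pat b)
  to refl = here (≡⇒Pointwise-≡ refl)
  from : ∀ {b} → Suffix _≡_ w (pat b) → pat b ≡ w
  from {b} w≼pat = sym (Pointwise-≡⇒≡ (toPointwise (trans ∣w∣≡lam (sym (length-pat b))) w≼pat))

above : ℕ → ℕ → Letter
above T A = if does (T <? A) then f else v

above-< : ∀ {T A} → T < A → above T A ≡ f
above-< {T} {A} T<A = cong (if_then f else v) (dec-true (T <? A) T<A)

above-≤ : ∀ {T A} → A ≤ T → above T A ≡ v
above-≤ {T} {A} A≤T = cong (if_then f else v) (dec-false (T <? A) (≤⇒≯ A≤T))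

-- Since N M ≡ -1 modulo 1 + N M, the residue of M (1 + s + q N) is M (1 + s) - q.
residue : ∀ M N s q A → s < N → A + q ≡ M * suc s → M * suc (s + q * N) % suc (N * M) ≡ A
residue M N s q A s<N A+q≡ =
  trans (cong (_% suc (N * M)) expand)
    (trans ([m+kn]%n≡m%n A q (suc (N * M))) (m<n⇒m%n≡m (s≤s A≤NM)))
  where
  distrib : ∀ M s q N → M * suc (s + q * N) ≡ M * suc s + q * (N * M)
  distrib = solve-∀
  regroup : ∀ A q K → A + q + q * K ≡ A + q * suc K
  regroup = solve-∀
  expand : M * suc (s + q * N) ≡ A + q * suc (N * M)
  expand = begin
    M * suc (s + q * N)          ≡⟨ distrib M s q N ⟩
    M * suc s + q * (N * M)      ≡⟨ cong (_+ q * (N * M)) (sym A+q≡) ⟩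
    A + q + q * (N * M)          ≡⟨ regroup A q (N * M) ⟩
    A + q * suc (N * M)          ∎
    where open ≡-Reasoning
  A≤NM : A ≤ N * M
  A≤NM = begin
    A           ≤⟨ m≤m+n A q ⟩
    A + q       ≡⟨ A+q≡ ⟩
    M * suc s   ≤⟨ *-monoʳ-≤ M s<N ⟩
    M * N       ≡⟨ *-comm M N ⟩
    N * M       ∎
    where open ≤-Reasoning

-- In use M = p^j = 2a + 1, the threshold 1 + (b M + a) is d/2 = H λ + 1 and A is the residue of p^j b.
above-digits : ∀ {a b s q A M} → M ≡ suc (a + a) → q < M → A + q ≡ M * suc s →
  above (suc (b * M + a)) A ≡ side s b (swap (side q a f))
above-digits {a} {b} {s} {q} {A} {M} refl q<M A+q≡ = by-cases (<-cmp s b)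
  where
  open ≤-Reasoning
  T : ℕ
  T = suc (b * M + a)
  T+a≡M[1+b] : T + a ≡ M * suc b
  T+a≡M[1+b] = regroup a b
    where
    regroup : ∀ a b → suc (b * suc (a + a) + a) + a ≡ suc (a + a) * suc b
    regroup = solve-∀
  by-cases : Tri (s < b) (s ≡ b) (b < s) → above T A ≡ side s b (swap (side q a f))
  by-cases (tri< s<b _ _) = trans (above-≤ A≤T) (sym (side-< _ s<b))
    where
    A≤T : A ≤ T
    A≤T = begin
      A           ≤⟨ m≤m+n A q ⟩
      A + q       ≡⟨ A+q≡ ⟩
      M * suc s   ≤⟨ *-monoʳ-≤ M s<b ⟩
      M * b       ≡⟨ *-comm M b ⟩
      b * M       ≤⟨ m≤m+n (b * M) a ⟩
      b * M + a   <⟨ n<1+n (b * M + a) ⟩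
      T           ∎
  by-cases (tri> _ _ b<s) = trans (above-< (+-cancelʳ-< q T A T+q<A+q)) (sym (side-> _ b<s))
    where
    T+q<A+q : T + q < A + q
    T+q<A+q = begin-strict
      T + q             <⟨ +-monoʳ-< T q<M ⟩
      T + M             ≤⟨ +-monoˡ-≤ M (subst (T ≤_) T+a≡M[1+b] (m≤m+n T a)) ⟩
      M * suc b + M     ≡⟨ trans (+-comm (M * suc b) M) (sym (*-suc M (suc b))) ⟩
      M * suc (suc b)   ≤⟨ *-monoʳ-≤ M (s≤s b<s) ⟩
      M * suc s         ≡⟨ A+q≡ ⟨
      A + q             ∎
  by-cases (tri≈ _ refl _) = trans (tie (q <? a)) (sym (side-≡ _ refl))
    where
    tie : Dec (q < a) → above T A ≡ swap (side q a f)
    tie (yes q<a) = trans (above-< (+-cancelʳ-< q T A T+q<A+q)) (cong swap (sym (side-< f q<a)))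
      where
      T+q<A+q : T + q < A + q
      T+q<A+q = begin-strict
        T + q       <⟨ +-monoʳ-< T q<a ⟩
        T + a       ≡⟨ T+a≡M[1+b] ⟩
        M * suc b   ≡⟨ A+q≡ ⟨
        A + q       ∎
    tie (no q≮a) = trans (above-≤ (+-cancelʳ-≤ q A T A+q≤T+q)) (cong swap (sym (side-≥ (≮⇒≥ q≮a))))
      where
      A+q≤T+q : A + q ≤ T + q
      A+q≤T+q = begin
        A + q       ≡⟨ A+q≡ ⟩
        M * suc b   ≡⟨ T+a≡M[1+b] ⟨
        T + a       ≤⟨ +-monoʳ-≤ T (≮⇒≥ q≮a) ⟩
        T + q       ∎

module OddBase (h : ℕ) where

  p : ℕ
  p = suc (h + h)

  p^≢0 : ∀ m → NonZero (p ^ m)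
  p^≢0 m = m^n≢0 p m

  -- Instance search cannot find NonZero (p ^ m) for a variable m, hence these wrappers.
  low high : ℕ → ℕ → ℕ
  low  m n = _%_ n (p ^ m) {{p^≢0 m}}
  high m n = _/_ n (p ^ m) {{p^≢0 m}}

  low<p^ : ∀ m n → low m n < p ^ m
  low<p^ m n = m%n<n n (p ^ m) {{p^≢0 m}}

  low+high : ∀ m n → n ≡ low m n + high m n * p ^ m
  low+high m n = m≡m%n+[m/n]*n n (p ^ m) {{p^≢0 m}}

  low-< : ∀ m {n} → n < p ^ m → low m n ≡ n
  low-< m n< = m<n⇒m%n≡m {{p^≢0 m}} n<

  low-low : ∀ m n → low m (low (suc m) n) ≡ low m n
  low-low m n = m∣n⇒o%n%m≡o%m (p ^ m) (p ^ suc m) n {{p^≢0 m}} {{p^≢0 (suc m)}} (divides p refl)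

  high<p^ : ∀ m j n → n < p ^ (m + j) → high m n < p ^ j
  high<p^ m j n n< = m<n*o⇒m/o<n {{p^≢0 m}} (subst (n <_) (trans (^-distribˡ-+-* p m j) (*-comm (p ^ m) (p ^ j))) n<)

  H : ℕ → ℕ
  H zero    = 0
  H (suc m) = H m + h * p ^ m

  p^≡suc-double-H : ∀ m → p ^ m ≡ suc (H m + H m)
  p^≡suc-double-H zero    = refl
  p^≡suc-double-H (suc m) rewrite p^≡suc-double-H m = regroup (H m) h
    where
    regroup : ∀ a h → suc (h + h) * suc (a + a) ≡ suc (a + h * suc (a + a) + (a + h * suc (a + a)))
    regroup = solve-∀

  H<p^ : ∀ m → H m < p ^ m
  H<p^ m rewrite p^≡suc-double-H m = s≤s (m≤m+n (H m) (H m))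

  H-+ : ∀ m n → H (m + n) ≡ H m * p ^ n + H n
  H-+ zero    n = refl
  H-+ (suc m) n rewrite H-+ m n | ^-distribˡ-+-* p m n = regroup (H m) (p ^ n) (H n) (p ^ m) h
    where
    regroup : ∀ a N b M h → a * N + b + h * (M * N) ≡ (a + h * M) * N + b
    regroup = solve-∀

  half≡suc-H : ∀ lam → Setup.half p lam ≡ suc (H lam)
  half≡suc-H lam = trans (cong (λ x → suc x / 2) (p^≡suc-double-H lam)) (half-suc-double (H lam))

  letter-digits : ∀ m j s q → s < p ^ m → q < p ^ j →
    Setup.letter p (m + j) (suc (s + q * p ^ m)) j ≡ side s (H m) (swap (side q (H j) f))
  letter-digits m j s q s< q< = begin
    above (Setup.half p (m + j)) (p ^ j * suc (s + q * p ^ m) % suc (p ^ (m + j)))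
      ≡⟨ cong₂ above (trans (half≡suc-H (m + j)) (cong suc (H-+ m j)))
                     (trans (cong (λ N → p ^ j * suc (s + q * p ^ m) % suc N) (^-distribˡ-+-* p m j))
                            (residue (p ^ j) (p ^ m) s q A s< A+q≡)) ⟩
    above (suc (H m * p ^ j + H j)) A
      ≡⟨ above-digits (p^≡suc-double-H j) q< A+q≡ ⟩
    side s (H m) (swap (side q (H j) f)) ∎
    where
    open ≡-Reasoning
    A : ℕ
    A = p ^ j * suc s ∸ q
    A+q≡ : A + q ≡ p ^ j * suc s
    A+q≡ = m∸n+n≡m (≤-trans (<⇒≤ q<) (m≤m*n (p ^ j) (suc s)))

  letter-side : ∀ {lam} m j n → m + j ≡ lam → n < p ^ lam →
    Setup.letter p lam (suc n) j ≡ side (low m n) (H m) (swap (side n (H lam) f))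
  letter-side m j n refl n< = begin
    Setup.letter p (m + j) (suc n) j
      ≡⟨ cong (λ x → Setup.letter p (m + j) (suc x) j) (low+high m n) ⟩
    Setup.letter p (m + j) (suc (s + q * p ^ m)) j
      ≡⟨ letter-digits m j s q (low<p^ m n) (high<p^ m j n n<) ⟩
    side s (H m) (swap (side q (H j) f))
      ≡⟨ side-tie (cong swap ∘ tie) ⟩
    side s (H m) (swap (side n (H (m + j)) f)) ∎
    where
    open ≡-Reasoning
    s q : ℕ
    s = low m n
    q = high m n
    tie : s ≡ H m → side q (H j) f ≡ side n (H (m + j)) f
    tie s≡H = sym (begin
      side n (H (m + j)) f
        ≡⟨ cong₂ (λ x y → side x y f) (low+high m n)
                 (trans (cong H (+-comm m j)) (trans (H-+ j m) (+-comm (H j * p ^ m) (H m)))) ⟩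
      side (s + q * p ^ m) (H m + H j * p ^ m) f
        ≡⟨ side-lex {a = q} {b = H j} f (low<p^ m n) (H<p^ m) ⟩
      side q (H j) (side s (H m) f)
        ≡⟨ cong (side q (H j)) (side-≡ f s≡H) ⟩
      side q (H j) f ∎)

  sideWord : ℕ → ℕ → Letter → Word
  sideWord zero    n z = []
  sideWord (suc m) n z = side n (H (suc m)) z ∷ sideWord m (low m n) z

  sideWord-low : ∀ m n z → sideWord m (low m n) z ≡ applyUpTo (λ j → side (low (m ∸ j) n) (H (m ∸ j)) z) m
  sideWord-low zero    n z = refl
  sideWord-low (suc m) n z = cong (side (low (suc m) n) (H (suc m)) z ∷_)
    (trans (cong (λ r → sideWord m r z) (low-low m n)) (sideWord-low m n z))

  pat-sideWord : ∀ lam n → n < p ^ lam → Setup.pat p lam (suc n) ≡ reverse (sideWord lam n (swap (side n (H lam) f)))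
  pat-sideWord lam n n< = cong reverse (begin
    map (Setup.letter p lam (suc n)) (upTo lam)
      ≡⟨ map-cong-local (applyUpTo⁺₁ id lam (λ {j} j< → letter-side (lam ∸ j) j n (m∸n+n≡m (<⇒≤ j<)) n<)) ⟩
    map F (upTo lam)
      ≡⟨ map-upTo F lam ⟩
    applyUpTo F lam
      ≡⟨ sideWord-low lam n z ⟨
    sideWord lam (low lam n) z
      ≡⟨ cong (λ r → sideWord lam r z) (low-< lam n<) ⟩
    sideWord lam n z ∎)
    where
    open ≡-Reasoning
    z : Letter
    z = swap (side n (H lam) f)
    F : ℕ → Letter
    F j = side (low (lam ∸ j) n) (H (lam ∸ j)) z

  weight : Letter → Word → Letter → ℕ → ℕ
  weight u []      z m = H m + δ u z
  weight u (x ∷ t) z m = (h + δ u x) * weight x t z m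

  -- Splitting off the leading digit a of n, the first letter is side a h applied to the next one,
  -- so each letter u followed by x is produced by h + δ u x of the p values of a.
  count-prefix : ∀ u t z m → length t < m →
    count (λ n → isPrefix (u ∷ t) (sideWord m n z)) (p ^ m) ≡ weight u t z (m ∸ length t)
  count-prefix u []      z (suc m) _ = begin
    count (λ n → does (u ≟L side n (H (suc m)) z) ∧ true) (p ^ suc m)
      ≡⟨ count-cong (p ^ suc m) (λ _ → ∧-identityʳ _) ⟩
    count (λ n → does (u ≟L side n (H (suc m)) z)) (p ^ suc m)
      ≡⟨ cong (count _) (p^≡suc-double-H (suc m)) ⟩
    count (λ n → does (u ≟L side n (H (suc m)) z)) (suc (H (suc m) + H (suc m)))
      ≡⟨ count-side (H (suc m)) z u ⟩
    H (suc m) + δ u z ∎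
    where open ≡-Reasoning
  count-prefix u (x ∷ t) z (suc zero)    (s≤s ())
  count-prefix u (x ∷ t) z (suc (suc m)) (s≤s t<) = begin
    count (λ n → isPrefix (u ∷ x ∷ t) (sideWord (suc (suc m)) n z)) (p * N)
      ≡⟨ count-cong (p * N) (λ {n} _ → split n) ⟩
    count (λ n → g (high (suc m) n) ∧ k (low (suc m) n)) (p * N)
      ≡⟨ count-/-% p N {{p^≢0 (suc m)}} g k ⟩
    count g p * count k N
      ≡⟨ cong₂ _*_ (count-side h x u) (count-prefix x t z (suc m) t<) ⟩
    (h + δ u x) * weight x t z (suc m ∸ length t) ∎
    where
    open ≡-Reasoning
    N : ℕ
    N = p ^ suc m
    g k : ℕ → Bool
    g a = does (u ≟L side a h x)
    k r = isPrefix (x ∷ t) (sideWord (suc m) r z)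
    split : ∀ n → isPrefix (u ∷ x ∷ t) (sideWord (suc (suc m)) n z) ≡ g (high (suc m) n) ∧ k (low (suc m) n)
    split n = begin
      does (u ≟L side n (H (suc (suc m))) z) ∧ k r
        ≡⟨ cong (λ y → does (u ≟L side y (H (suc (suc m))) z) ∧ k r) (low+high (suc m) n) ⟩
      does (u ≟L side (r + a * N) (H (suc m) + h * N) z) ∧ k r
        ≡⟨ cong (λ c → does (u ≟L c) ∧ k r) (side-lex {a = a} {b = h} z (low<p^ (suc m) n) (H<p^ (suc m))) ⟩
      does (u ≟L side a h (side r (H (suc m)) z)) ∧ k r
        ≡⟨ ∧-guard (λ c → does (u ≟L side a h c)) x (side r (H (suc m)) z) _ ⟩
      g a ∧ k r ∎
      where
      r a : ℕ
      r = low (suc m) n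
      a = high (suc m) n

  -- Away from n = H λ the first letter does not depend on the tie letter, and a word whose first letter
  -- differs from u is rejected either way.
  prefix-sideWord-tie : ∀ l n u t → n ≢ H (suc l) →
    isPrefix (u ∷ t) (sideWord (suc l) n (swap (side n (H (suc l)) f))) ≡ isPrefix (u ∷ t) (sideWord (suc l) n (swap u))
  prefix-sideWord-tie l n u t n≢H = agree (c ≟L u)
    where
    c : Letter
    c = side n (H (suc l)) f
    u≢first : ∀ z → c ≢ u → u ≢ side n (H (suc l)) z
    u≢first z c≢u u≡ = c≢u (sym (trans u≡ (side-tie (λ n≡H → ⊥-elim (n≢H n≡H)))))
    agree : Dec (c ≡ u) → isPrefix (u ∷ t) (sideWord (suc l) n (swap c)) ≡ isPrefix (u ∷ t) (sideWord (suc l) n (swap u))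
    agree (yes refl) = refl
    agree (no c≢u)   = trans (isPrefix-≢ t _ (u≢first (swap c) c≢u)) (sym (isPrefix-≢ t _ (u≢first (swap u) c≢u)))

  -- For n = H λ, i.e. b = d/2 ∉ S, the tie letter swap u rejects the word as well.
  suffix-pat≡prefix-sideWord : ∀ l n u t → n < p ^ suc l →
    not (does (suc n ≟ Setup.half p (suc l))) ∧ does (suffix? _≟L_ (reverse (u ∷ t)) (Setup.pat p (suc l) (suc n)))
      ≡ isPrefix (u ∷ t) (sideWord (suc l) n (swap u))
  suffix-pat≡prefix-sideWord l n u t n< = by-tie (n ≟ H lam)
    where
    open ≡-Reasoning
    lam : ℕ
    lam = suc l
    open Setup p lam
    by-tie : Dec (n ≡ H lam) → not (does (suc n ≟ half)) ∧ does (suffix? _≟L_ (reverse (u ∷ t)) (pat (suc n)))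
                                 ≡ isPrefix (u ∷ t) (sideWord lam n (swap u))
    by-tie (yes refl) rewrite dec-true (suc n ≟ half) (sym (half≡suc-H lam)) =
      sym (isPrefix-≢ t _ (λ u≡ → swap-≢ u (trans u≡ (side-≡ (swap u) refl))))
    by-tie (no n≢H) rewrite dec-false (suc n ≟ half) (λ eq → n≢H (suc-injective (trans eq (half≡suc-H lam)))) = begin
      does (suffix? _≟L_ (reverse (u ∷ t)) (pat (suc n)))
        ≡⟨ cong (does ∘ suffix? _≟L_ (reverse (u ∷ t))) (pat-sideWord lam n n<) ⟩
      does (suffix? _≟L_ (reverse (u ∷ t)) (reverse (sideWord lam n (swap (side n (H lam) f)))))
        ≡⟨ isSuffix-reverse (u ∷ t) (sideWord lam n (swap (side n (H lam) f))) ⟩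
      isPrefix (u ∷ t) (sideWord lam n (swap (side n (H lam) f)))
        ≡⟨ prefix-sideWord-tie l n u t n≢H ⟩
      isPrefix (u ∷ t) (sideWord lam n (swap u)) ∎

  -- The term b = 0 of the count over [0, d) vanishes by computation.
  μ-end-reverse : ∀ l u t → Setup.μ-end p (suc l) (reverse (u ∷ t))
    ≡ count (λ n → isPrefix (u ∷ t) (sideWord (suc l) n (swap u))) (p ^ suc l)
  μ-end-reverse l u t = trans
    (length-filter-filter (λ b → suffix? _≟L_ (reverse (u ∷ t)) (pat b)) (λ b → ¬? (b ≟ 0) ×-dec ¬? (b ≟ half)) id d)
    (count-cong (p ^ suc l) (λ {n} → suffix-pat≡prefix-sideWord l n u t))
    where open Setup p (suc l)

  weight-replicate : ∀ e x rest z m → weight x (replicate e x ++ rest) z m ≡ suc h ^ e * weight x rest z m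
  weight-replicate zero    x rest z m = sym (+-identityʳ (weight x rest z m))
  weight-replicate (suc e) x rest z m = begin
    (h + δ x x) * weight x (replicate e x ++ rest) z m
      ≡⟨ cong₂ _*_ (trans (cong (h +_) (δ-refl x)) (+-comm h 1)) (weight-replicate e x rest z m) ⟩
    suc h * (suc h ^ e * weight x rest z m)
      ≡⟨ *-assoc (suc h) (suc h ^ e) _ ⟨
    suc h ^ suc e * weight x rest z m ∎
    where open ≡-Reasoning

  weight-blocks : ∀ x e es z m → All (1 ≤_) es →
    weight x (replicate e x ++ blocksᴿ (swap x) es) z m
      ≡ suc h ^ (e + (sum es ∸ length es)) * h ^ length es * (H m + δ (blockLetter x (length es)) z)
  weight-blocks x e [] z m [] = begin
    weight x (replicate e x ++ []) z m
      ≡⟨ weight-replicate e x [] z m ⟩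
    suc h ^ e * (H m + δ x z)
      ≡⟨ cong (_* (H m + δ x z)) (sym (trans (*-identityʳ (suc h ^ (e + 0))) (cong (suc h ^_) (+-identityʳ e)))) ⟩
    suc h ^ (e + 0) * 1 * (H m + δ x z) ∎
    where open ≡-Reasoning
  weight-blocks x e (suc e′ ∷ es) z m (_ ∷ es⁺) = begin
    weight x (replicate e x ++ blocksᴿ (swap x) (suc e′ ∷ es)) z m
      ≡⟨ weight-replicate e x _ z m ⟩
    suc h ^ e * ((h + δ x (swap x)) * weight (swap x) (replicate e′ (swap x) ++ blocksᴿ (swap (swap x)) es) z m)
      ≡⟨ cong₂ (λ c w → suc h ^ e * ((h + c) * w)) (δ-swap x) (weight-blocks (swap x) e′ es z m es⁺) ⟩
    suc h ^ e * ((h + 0) * (suc h ^ (e′ + (sum es ∸ length es)) * h ^ length es * F))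
      ≡⟨ regroup (suc h ^ e) (suc h ^ (e′ + (sum es ∸ length es))) (h ^ length es) F h ⟩
    suc h ^ e * suc h ^ (e′ + (sum es ∸ length es)) * h ^ suc (length es) * F
      ≡⟨ cong (λ k → k * h ^ suc (length es) * F) (^-distribˡ-+-* (suc h) e _) ⟨
    suc h ^ (e + (e′ + (sum es ∸ length es))) * h ^ suc (length es) * F
      ≡⟨ cong (λ k → suc h ^ (e + k) * h ^ suc (length es) * F) (+-∸-assoc e′ (length≤sum es⁺)) ⟨
    suc h ^ (e + (e′ + sum es ∸ length es)) * h ^ suc (length es) * F ∎
    where
    open ≡-Reasoning
    F : ℕ
    F = H m + δ (blockLetter (swap x) (length es)) z
    regroup : ∀ A B C D h → A * ((h + 0) * (B * C * D)) ≡ A * B * (h * C) * D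
    regroup = solve-∀

  μ-end-blocks : ∀ {lam} x es → All (1 ≤_) es → 1 ≤ length es → sum es ≤ lam →
    Setup.μ-end p lam (blocks x es)
      ≡ suc h ^ (sum es ∸ length es) * h ^ (length es ∸ 1) * (H (lam + 1 ∸ sum es) + δ (blockLetter x (length es ∸ 1)) (swap x))
  μ-end-blocks x []           []      ()
  μ-end-blocks x (zero ∷ es)  (() ∷ _)
  μ-end-blocks {zero}  x (suc e ∷ es) _ _ ()
  μ-end-blocks {suc l} x (suc e ∷ es) (_ ∷ es⁺) _ (s≤s Σ≤l) = begin
    Setup.μ-end p (suc l) (blocks x (suc e ∷ es))
      ≡⟨ cong (Setup.μ-end p (suc l)) (blocks≡reverse-blocksᴿ x (suc e ∷ es)) ⟩
    Setup.μ-end p (suc l) (reverse (x ∷ t))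
      ≡⟨ μ-end-reverse l x t ⟩
    count (λ n → isPrefix (x ∷ t) (sideWord (suc l) n (swap x))) (p ^ suc l)
      ≡⟨ count-prefix x t (swap x) (suc l) (s≤s (subst (_≤ l) (sym ∣t∣≡) Σ≤l)) ⟩
    weight x t (swap x) (suc l ∸ length t)
      ≡⟨ cong (weight x t (swap x)) (trans (cong (suc l ∸_) ∣t∣≡) (cong (_∸ (e + sum es)) (+-comm 1 l))) ⟩
    weight x t (swap x) (l + 1 ∸ (e + sum es))
      ≡⟨ weight-blocks x e es (swap x) _ es⁺ ⟩
    suc h ^ (e + (sum es ∸ length es)) * h ^ length es * F
      ≡⟨ cong (λ k → suc h ^ k * h ^ length es * F) (+-∸-assoc e (length≤sum es⁺)) ⟨
    suc h ^ (e + sum es ∸ length es) * h ^ length es * F ∎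
    where
    open ≡-Reasoning
    t : Word
    t = replicate e x ++ blocksᴿ (swap x) es
    ∣t∣≡ : length t ≡ e + sum es
    ∣t∣≡ = trans (length-++ (replicate e x)) (cong₂ _+_ (length-replicate e) (length-blocksᴿ (swap x) es))
    F : ℕ
    F = H (l + 1 ∸ (e + sum es)) + δ (blockLetter x (length es)) (swap x)

  μ-blocks : ∀ {lam} x es → All (1 ≤_) es → sum es ≡ lam → 1 ≤ lam →
    Setup.μ p lam (blocks x es)
      ≡ suc h ^ (lam ∸ length es) * h ^ (length es ∸ 1) * (h + δ (blockLetter x (length es ∸ 1)) (swap x))
  μ-blocks x es es⁺ refl 1≤Σ = begin
    Setup.μ p (sum es) (blocks x es)
      ≡⟨ μ≡μ-end p (sum es) (blocks x es) (length-blocks x es) ⟩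
    Setup.μ-end p (sum es) (blocks x es)
      ≡⟨ μ-end-blocks x es es⁺ (nonempty es 1≤Σ) ≤-refl ⟩
    suc h ^ (sum es ∸ length es) * h ^ (length es ∸ 1) * (H (sum es + 1 ∸ sum es) + c)
      ≡⟨ cong (λ m → suc h ^ (sum es ∸ length es) * h ^ (length es ∸ 1) * (m + c))
              (trans (cong H (m+n∸m≡n (sum es) 1)) (*-identityʳ h)) ⟩
    suc h ^ (sum es ∸ length es) * h ^ (length es ∸ 1) * (h + c) ∎
    where
    open ≡-Reasoning
    c : ℕ
    c = δ (blockLetter x (length es ∸ 1)) (swap x)

  p₊ : (p + 1) / 2 ≡ suc h
  p₊ = trans (cong (_/ 2) (+-comm p 1)) (half-suc-double h)

  p₋ : (p ∸ 1) / 2 ≡ h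
  p₋ = half-double h

  [p^-1]/2 : ∀ m → (p ^ m ∸ 1) / 2 ≡ H m
  [p^-1]/2 m = trans (cong (λ x → (x ∸ 1) / 2) (p^≡suc-double-H m)) (half-double (H m))

  [p^+1]/2 : ∀ m → (p ^ m + 1) / 2 ≡ suc (H m)
  [p^+1]/2 m = trans (cong (λ x → (x + 1) / 2) (p^≡suc-double-H m))
    (trans (cong (_/ 2) (+-comm (suc (H m + H m)) 1)) (half-suc-double (H m)))

  μ-blocks-odd : ∀ {lam} x es → All (1 ≤_) es → sum es ≡ lam → 1 ≤ lam → length es % 2 ≡ 1 →
    Setup.μ p lam (blocks x es) ≡ ((p + 1) / 2) ^ (lam ∸ length es) * ((p ∸ 1) / 2) ^ length es
  μ-blocks-odd {lam} x es@(_ ∷ es′) es⁺ Σ≡ 1≤lam odd = begin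
    Setup.μ p lam (blocks x es)
      ≡⟨ μ-blocks x es es⁺ Σ≡ 1≤lam ⟩
    suc h ^ (lam ∸ length es) * h ^ length es′ * (h + δ (blockLetter x (length es′)) (swap x))
      ≡⟨ cong (λ y → suc h ^ (lam ∸ length es) * h ^ length es′ * (h + δ y (swap x))) (blockLetter-even x (length es′) odd) ⟩
    suc h ^ (lam ∸ length es) * h ^ length es′ * (h + δ x (swap x))
      ≡⟨ cong (λ c → suc h ^ (lam ∸ length es) * h ^ length es′ * (h + c)) (δ-swap x) ⟩
    suc h ^ (lam ∸ length es) * h ^ length es′ * (h + 0)
      ≡⟨ regroup (suc h ^ (lam ∸ length es)) (h ^ length es′) h ⟩
    suc h ^ (lam ∸ length es) * h ^ length es
      ≡⟨ cong₂ (λ a b → a ^ (lam ∸ length es) * b ^ length es) p₊ p₋ ⟨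
    ((p + 1) / 2) ^ (lam ∸ length es) * ((p ∸ 1) / 2) ^ length es ∎
    where
    open ≡-Reasoning
    regroup : ∀ A B h → A * B * (h + 0) ≡ A * (h * B)
    regroup = solve-∀

  μ-blocks-even : ∀ {lam} x es → All (1 ≤_) es → sum es ≡ lam → 1 ≤ lam → length es % 2 ≡ 0 →
    Setup.μ p lam (blocks x es) ≡ ((p + 1) / 2) ^ (lam + 1 ∸ length es) * ((p ∸ 1) / 2) ^ (length es ∸ 1)
  μ-blocks-even x [] _ refl ()
  μ-blocks-even {lam} x es@(_ ∷ es′) es⁺ Σ≡ 1≤lam even = begin
    Setup.μ p lam (blocks x es)
      ≡⟨ μ-blocks x es es⁺ Σ≡ 1≤lam ⟩
    suc h ^ (lam ∸ length es) * h ^ length es′ * (h + δ (blockLetter x (length es′)) (swap x))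
      ≡⟨ cong (λ y → suc h ^ (lam ∸ length es) * h ^ length es′ * (h + δ y (swap x))) (blockLetter-odd x (length es′) even) ⟩
    suc h ^ (lam ∸ length es) * h ^ length es′ * (h + δ (swap x) (swap x))
      ≡⟨ cong (λ c → suc h ^ (lam ∸ length es) * h ^ length es′ * (h + c)) (δ-refl (swap x)) ⟩
    suc h ^ (lam ∸ length es) * h ^ length es′ * (h + 1)
      ≡⟨ regroup (suc h ^ (lam ∸ length es)) (h ^ length es′) h ⟩
    suc h ^ suc (lam ∸ length es) * h ^ length es′
      ≡⟨ cong (λ k → suc h ^ k * h ^ length es′) exponent ⟨
    suc h ^ (lam + 1 ∸ length es) * h ^ length es′
      ≡⟨ cong₂ (λ a b → a ^ (lam + 1 ∸ length es) * b ^ length es′) p₊ p₋ ⟨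
    ((p + 1) / 2) ^ (lam + 1 ∸ length es) * ((p ∸ 1) / 2) ^ length es′ ∎
    where
    open ≡-Reasoning
    regroup : ∀ A B h → A * B * (h + 1) ≡ suc h * A * B
    regroup = solve-∀
    exponent : lam + 1 ∸ length es ≡ suc (lam ∸ length es)
    exponent = trans (+-∸-comm 1 (subst (length es ≤_) Σ≡ (length≤sum es⁺))) (+-comm (lam ∸ length es) 1)

  μ-end-blocks-odd : ∀ {lam} x es → All (1 ≤_) es → 1 ≤ length es → sum es ≤ lam → length es % 2 ≡ 1 →
    Setup.μ-end p lam (blocks x es)
      ≡ ((p + 1) / 2) ^ (sum es ∸ length es) * ((p ∸ 1) / 2) ^ (length es ∸ 1) * ((p ^ (lam + 1 ∸ sum es) ∸ 1) / 2)
  μ-end-blocks-odd {lam} x es@(_ ∷ es′) es⁺ 1≤k Σ≤lam odd = begin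
    Setup.μ-end p lam (blocks x es)
      ≡⟨ μ-end-blocks x es es⁺ 1≤k Σ≤lam ⟩
    suc h ^ A * h ^ length es′ * (H M + δ (blockLetter x (length es′)) (swap x))
      ≡⟨ cong (λ y → suc h ^ A * h ^ length es′ * (H M + δ y (swap x))) (blockLetter-even x (length es′) odd) ⟩
    suc h ^ A * h ^ length es′ * (H M + δ x (swap x))
      ≡⟨ cong (λ c → suc h ^ A * h ^ length es′ * c) (trans (cong (H M +_) (δ-swap x)) (+-identityʳ (H M))) ⟩
    suc h ^ A * h ^ length es′ * H M
      ≡⟨ cong₂ _*_ (cong₂ (λ a b → a ^ A * b ^ length es′) p₊ p₋) ([p^-1]/2 M) ⟨
    ((p + 1) / 2) ^ A * ((p ∸ 1) / 2) ^ length es′ * ((p ^ M ∸ 1) / 2) ∎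
    where
    open ≡-Reasoning
    A M : ℕ
    A = sum es ∸ length es
    M = lam + 1 ∸ sum es

  μ-end-blocks-even : ∀ {lam} x es → All (1 ≤_) es → 1 ≤ length es → sum es ≤ lam → length es % 2 ≡ 0 →
    Setup.μ-end p lam (blocks x es)
      ≡ ((p + 1) / 2) ^ (sum es ∸ length es) * ((p ∸ 1) / 2) ^ (length es ∸ 1) * ((p ^ (lam + 1 ∸ sum es) + 1) / 2)
  μ-end-blocks-even {lam} x es@(_ ∷ es′) es⁺ 1≤k Σ≤lam even = begin
    Setup.μ-end p lam (blocks x es)
      ≡⟨ μ-end-blocks x es es⁺ 1≤k Σ≤lam ⟩
    suc h ^ A * h ^ length es′ * (H M + δ (blockLetter x (length es′)) (swap x))
      ≡⟨ cong (λ y → suc h ^ A * h ^ length es′ * (H M + δ y (swap x))) (blockLetter-odd x (length es′) even) ⟩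
    suc h ^ A * h ^ length es′ * (H M + δ (swap x) (swap x))
      ≡⟨ cong (λ c → suc h ^ A * h ^ length es′ * c) (trans (cong (H M +_) (δ-refl (swap x))) (+-comm (H M) 1)) ⟩
    suc h ^ A * h ^ length es′ * suc (H M)
      ≡⟨ cong₂ _*_ (cong₂ (λ a b → a ^ A * b ^ length es′) p₊ p₋) ([p^+1]/2 M) ⟨
    ((p + 1) / 2) ^ A * ((p ∸ 1) / 2) ^ length es′ * ((p ^ M + 1) / 2) ∎
    where
    open ≡-Reasoning
    A M : ℕ
    A = sum es ∸ length es
    M = lam + 1 ∸ sum es

proposition11p1 : (p lam : ℕ) → Prime p → ¬ (2 ∣ p) → 1 ≤ lam →
    let open Setup p lam in
    ((es : List ℕ) → All (1 ≤_) es → sum es ≡ lam →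
      (length es % 2 ≡ 1 →
        (μ (blocks f es) ≡ ((p + 1) / 2) ^ (lam ∸ length es) * ((p ∸ 1) / 2) ^ length es)
        × (μ (blocks f es ᶜ) ≡ ((p + 1) / 2) ^ (lam ∸ length es) * ((p ∸ 1) / 2) ^ length es))
      × (length es % 2 ≡ 0 →
        (μ (blocks f es) ≡ ((p + 1) / 2) ^ (lam + 1 ∸ length es) * ((p ∸ 1) / 2) ^ (length es ∸ 1))
        × (μ (blocks f es ᶜ) ≡ ((p + 1) / 2) ^ (lam + 1 ∸ length es) * ((p ∸ 1) / 2) ^ (length es ∸ 1))))
    ×
    ((es : List ℕ) → All (1 ≤_) es → 1 ≤ length es → sum es ≤ lam →
      (length es % 2 ≡ 1 →
        (μ-end (blocks f es) ≡ ((p + 1) / 2) ^ (sum es ∸ length es) * ((p ∸ 1) / 2) ^ (length es ∸ 1) * ((p ^ (lam + 1 ∸ sum es) ∸ 1) / 2))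
        × (μ-end (blocks f es ᶜ) ≡ ((p + 1) / 2) ^ (sum es ∸ length es) * ((p ∸ 1) / 2) ^ (length es ∸ 1) * ((p ^ (lam + 1 ∸ sum es) ∸ 1) / 2)))
      × (length es % 2 ≡ 0 →
        (μ-end (blocks f es) ≡ ((p + 1) / 2) ^ (sum es ∸ length es) * ((p ∸ 1) / 2) ^ (length es ∸ 1) * ((p ^ (lam + 1 ∸ sum es) + 1) / 2))
        × (μ-end (blocks f es ᶜ) ≡ ((p + 1) / 2) ^ (sum es ∸ length es) * ((p ∸ 1) / 2) ^ (length es ∸ 1) * ((p ^ (lam + 1 ∸ sum es) + 1) / 2))))
proposition11p1 p lam _ p-odd 1≤lam with odd⇒suc-double p-odd
... | h , refl =
  (λ es es⁺ Σ≡lam →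
    (λ odd  → with-complement (λ w → Setup.μ p lam w ≡ _) es λ x → μ-blocks-odd x es es⁺ Σ≡lam 1≤lam odd) ,
    (λ even → with-complement (λ w → Setup.μ p lam w ≡ _) es λ x → μ-blocks-even x es es⁺ Σ≡lam 1≤lam even)) ,
  (λ es es⁺ 1≤k Σ≤lam →
    (λ odd  → with-complement (λ w → Setup.μ-end p lam w ≡ _) es λ x → μ-end-blocks-odd x es es⁺ 1≤k Σ≤lam odd) ,
    (λ even → with-complement (λ w → Setup.μ-end p lam w ≡ _) es λ x → μ-end-blocks-even x es es⁺ 1≤k Σ≤lam even))
  where open OddBase h hiding (p)
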